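{- Let $P$ be a countable direct sum of at least two non-empty connected $NE$-free posets. If some sibling of $P$ is connected, then $P$ has infinitely many siblings.
   Context: A poset is $NE$-free if it has no induced subposet isomorphic to $N$: the poset on $\{a,b,c,d\}$ with $a<b$, $c<b$, $c<d$ and $a,c$; $b,d$; $a,d$ pairwise incomparable. Direct sum: disjoint union with elements of different summands incomparable. A poset is connected if its comparability graph is connected. Siblings: posets each embedding (as induced subposet) in the other; counted up to isomorphism. -}

module Defs where

open import Data.Nat using (ℕ)
open import Data.Product using (Σ; ∃; _×_; _,_)
open import Data.Sum using (_⊎_)
open import Relation.Nullary using (¬_)
open import Relation.Binary.PropositionalEquality using (_≡_; _≢_; refl; isEquivalence)
open import Relation.Binary.Structures using (IsPartialOrder; IsPreorder)
open import Relation.Binary.Construct.Closure.ReflexiveTransitive using (Star)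
open import Function.Definitions using (Injective; Surjective)

record Poset : Set₁ where
  field
    Carrier : Set
    _≤_     : Carrier → Carrier → Set
    isPartialOrder : IsPartialOrder _≡_ _≤_

open Poset public

Countable : Set → Set
Countable A = Σ (A → ℕ) λ f → Injective _≡_ _≡_ f

record Embedding (P Q : Poset) : Set where
  field
    fun  : Carrier P → Carrier Q
    inj  : Injective _≡_ _≡_ fun
    mono : ∀ x y → _≤_ P x y → _≤_ Q (fun x) (fun y)
    refl-≤ : ∀ x y → _≤_ Q (fun x) (fun y) → _≤_ P x y

record Iso (P Q : Poset) : Set where
  field
    emb  : Embedding P Q
    surj : ∀ y → Σ (Carrier P) λ x → Embedding.fun emb x ≡ y

Sibling : Poset → Poset → Set
Sibling P Q = Embedding P Q × Embedding Q P

Comparable : (P : Poset) → Carrier P → Carrier P → Set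
Comparable P x y = _≤_ P x y ⊎ _≤_ P y x

Connected : Poset → Set
Connected P = ∀ x y → Star (Comparable P) x y

NonEmpty : Poset → Set
NonEmpty P = Carrier P

data NElt : Set where
  a b c d : NElt

data _≤N_ : NElt → NElt → Set where
  ≤N-refl : ∀ {x} → x ≤N x
  a≤b : a ≤N b
  c≤b : c ≤N b
  c≤d : c ≤N d

private
  ≤N-reflexive : ∀ {x y} → x ≡ y → x ≤N y
  ≤N-reflexive refl = ≤N-refl

  ≤N-trans : ∀ {x y z} → x ≤N y → y ≤N z → x ≤N z
  ≤N-trans ≤N-refl q = q
  ≤N-trans a≤b ≤N-refl = a≤b
  ≤N-trans c≤b ≤N-refl = c≤b
  ≤N-trans c≤d ≤N-refl = c≤d

  ≤N-antisym : ∀ {x y} → x ≤N y → y ≤N x → x ≡ y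
  ≤N-antisym ≤N-refl _ = refl
  ≤N-antisym a≤b ()
  ≤N-antisym c≤b ()
  ≤N-antisym c≤d ()

NPoset : Poset
NPoset = record
  { Carrier = NElt
  ; _≤_ = _≤N_
  ; isPartialOrder = record
      { isPreorder = record
          { isEquivalence = isEquivalence
          ; reflexive = ≤N-reflexive
          ; trans = ≤N-trans }
      ; antisym = ≤N-antisym } }

NEFree : Poset → Set
NEFree P = ¬ Embedding NPoset P

module _ {I : Set} (F : I → Poset) where
  data SumLe : Σ I (λ i → Carrier (F i)) → Σ I (λ i → Carrier (F i)) → Set where
    inSum : ∀ {i x y} → _≤_ (F i) x y → SumLe (i , x) (i , y)

  private
    C = Σ I (λ i → Carrier (F i))

    sreflexive : ∀ {p q : C} → p ≡ q → SumLe p q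
    sreflexive {i , x} refl = inSum (IsPartialOrder.refl (isPartialOrder (F i)))

    strans : ∀ {p q r : C} → SumLe p q → SumLe q r → SumLe p r
    strans {i , _} (inSum u) (inSum v) = inSum (IsPartialOrder.trans (isPartialOrder (F i)) u v)

    santisym : ∀ {p q : C} → SumLe p q → SumLe q p → p ≡ q
    santisym {i , _} (inSum u) (inSum v) with IsPartialOrder.antisym (isPartialOrder (F i)) u v
    ... | refl = refl

  DirectSum : Poset
  DirectSum = record
    { Carrier = C
    ; _≤_ = SumLe
    ; isPartialOrder = record
        { isPreorder = record
            { isEquivalence = isEquivalence
            ; reflexive = sreflexive
            ; trans = strans }
        ; antisym = santisym } }

InfinitelyManySiblings : Poset → Set₁
InfinitelyManySiblings P =
  Σ (ℕ → Poset) λ S → (∀ n → Sibling (S n) P) × (∀ m n → m ≢ n → ¬ Iso (S m) (S n))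

{-# OPTIONS --safe #-}
module Submission where

open import Defs
open import Data.Empty using (⊥-elim)
open import Data.Fin using (Fin; zero; suc)
import Data.Fin.Properties as Fin
open import Data.Nat as ℕ using (ℕ; zero; suc)
open import Data.Nat.Properties using (≤-antisym; +-cancelʳ-≡)
open import Data.Product using (Σ; _×_; _,_; proj₁; proj₂)
open import Data.Sum as Sum using (inj₁; inj₂)
open import Data.Sum.Properties using (inj₁-injective; inj₂-injective)
open import Data.Sum.Relation.Binary.Pointwise as Pointwise
  using (Pointwise; inj₁; inj₂; ⊎-isPartialOrder; ≡⇒Pointwise-≡; Pointwise-≡⇒≡)
open import Function using (_∘_)
open import Relation.Binary.Construct.Closure.ReflexiveTransitive using (Star; ε; _◅_; gmap)
open import Relation.Binary.Definitions using (DecidableEquality)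
open import Relation.Binary.PropositionalEquality
  using (_≡_; _≢_; refl; sym; trans; cong; subst₂; isEquivalence)
open import Relation.Binary.Structures using (IsPartialOrder)
open import Relation.Nullary using (¬_; yes; no)
open import Relation.Nullary.Decidable using (map′)

-- A connected sibling Q of P = ⨁ Fᵢ lands inside a single summand F_j, so for k ≠ j the
-- poset Q ⊕ F_k still embeds in P, hence in Q.  Iterating, Q ⊕ F_k ⊕ ⋯ ⊕ F_k (n copies)
-- embeds in Q, and it contains Q; so all of these are siblings of P, and they are pairwise
-- non-isomorphic because they have n + 1 connected components.

_∘ᴱ_ : {X Y Z : Poset} → Embedding Y Z → Embedding X Y → Embedding X Z
g ∘ᴱ f = record
  { fun    = G.fun ∘ F.fun
  ; inj    = F.inj ∘ G.inj
  ; mono   = λ x y → G.mono _ _ ∘ F.mono x y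
  ; refl-≤ = λ x y → F.refl-≤ x y ∘ G.refl-≤ _ _
  }
  where
    module F = Embedding f
    module G = Embedding g

Embedding-id : {X : Poset} → Embedding X X
Embedding-id = record { fun = λ x → x ; inj = λ e → e ; mono = λ _ _ p → p ; refl-≤ = λ _ _ p → p }

Embedding-map-path : {X Y : Poset} (f : Embedding X Y) {x y : Carrier X} →
  Star (Comparable X) x y → Star (Comparable Y) (Embedding.fun f x) (Embedding.fun f y)
Embedding-map-path f = gmap fun (Sum.map (mono _ _) (mono _ _))
  where open Embedding f

module _ {X Y : Poset} (φ : Iso X Y) where
  open Iso φ
  open Embedding emb

  Iso-inverse : Carrier Y → Carrier X
  Iso-inverse y = proj₁ (surj y)

  Iso-fun∘inverse : ∀ y → fun (Iso-inverse y) ≡ y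
  Iso-fun∘inverse y = proj₂ (surj y)

  Iso-inverse∘fun : ∀ x → Iso-inverse (fun x) ≡ x
  Iso-inverse∘fun x = inj (Iso-fun∘inverse (fun x))

  Iso-sym : Iso Y X
  Iso-sym = record
    { emb = record
        { fun    = Iso-inverse
        ; inj    = λ {y} {y′} e →
            trans (sym (Iso-fun∘inverse y)) (trans (cong fun e) (Iso-fun∘inverse y′))
        ; mono   = λ y y′ p → refl-≤ _ _
            (subst₂ (_≤_ Y) (sym (Iso-fun∘inverse y)) (sym (Iso-fun∘inverse y′)) p)
        ; refl-≤ = λ y y′ p → subst₂ (_≤_ Y) (Iso-fun∘inverse y) (Iso-fun∘inverse y′) (mono _ _ p)
        }
    ; surj = λ x → fun x , Iso-inverse∘fun x
    }

  Iso-reflects-path : ∀ {x x′} →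
    Star (Comparable Y) (fun x) (fun x′) → Star (Comparable X) x x′
  Iso-reflects-path p =
    subst₂ (Star (Comparable X)) (Iso-inverse∘fun _) (Iso-inverse∘fun _)
      (Embedding-map-path (Iso.emb Iso-sym) p)

-- `ComponentLabelling X n` witnesses that X has exactly n connected components.
record ComponentLabelling (X : Poset) (n : ℕ) : Set where
  field
    label                : Carrier X → Fin n
    label-step           : ∀ {x y} → Comparable X x y → label x ≡ label y
    path                 : ∀ {x y} → label x ≡ label y → Star (Comparable X) x y
    representative       : Fin n → Carrier X
    label-representative : ∀ i → label (representative i) ≡ i

  label-path : ∀ {x y} → Star (Comparable X) x y → label x ≡ label y
  label-path ε       = refl
  label-path (s ◅ p) = trans (label-step s) (label-path p)

components-≤ : {X Y : Poset} {m n : ℕ} →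
  Iso X Y → ComponentLabelling X m → ComponentLabelling Y n → m ℕ.≤ n
components-≤ φ cX cY = Fin.injective⇒≤ {f = Y.label ∘ fun ∘ X.representative} injective
  where
    module X = ComponentLabelling cX
    module Y = ComponentLabelling cY
    open Embedding (Iso.emb φ)
    injective : ∀ {i i′} →
      Y.label (fun (X.representative i)) ≡ Y.label (fun (X.representative i′)) → i ≡ i′
    injective {i} {i′} e = trans (sym (X.label-representative i))
      (trans (X.label-path (Iso-reflects-path φ (Y.path e))) (X.label-representative i′))

components-unique : {X Y : Poset} {m n : ℕ} →
  Iso X Y → ComponentLabelling X m → ComponentLabelling Y n → m ≡ n
components-unique φ cX cY = ≤-antisym (components-≤ φ cX cY) (components-≤ (Iso-sym φ) cY cX)

connected-labelling : {X : Poset} → Connected X → Carrier X → ComponentLabelling X 1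
connected-labelling conX x₀ = record
  { label                = λ _ → zero
  ; label-step           = λ _ → refl
  ; path                 = λ {x} {y} _ → conX x y
  ; representative       = λ _ → x₀
  ; label-representative = λ { zero → refl }
  }

_⊕_ : Poset → Poset → Poset
X ⊕ Y = record
  { Carrier        = Carrier X Sum.⊎ Carrier Y
  ; _≤_            = Pointwise (_≤_ X) (_≤_ Y)
  ; isPartialOrder = record
      { isPreorder = record
          { isEquivalence = isEquivalence
          ; reflexive     = ⊎.reflexive ∘ ≡⇒Pointwise-≡
          ; trans         = ⊎.trans
          }
      ; antisym    = λ p q → Pointwise-≡⇒≡ (⊎.antisym p q)
      }
  }
  where module ⊎ = IsPartialOrder (⊎-isPartialOrder (isPartialOrder X) (isPartialOrder Y))

⊕-inj₁ : {X Y : Poset} → Embedding X (X ⊕ Y)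
⊕-inj₁ = record
  { fun = inj₁ ; inj = inj₁-injective ; mono = λ _ _ → inj₁ ; refl-≤ = λ { _ _ (inj₁ p) → p } }

⊕-inj₂ : {X Y : Poset} → Embedding Y (X ⊕ Y)
⊕-inj₂ = record
  { fun = inj₂ ; inj = inj₂-injective ; mono = λ _ _ → inj₂ ; refl-≤ = λ { _ _ (inj₂ p) → p } }

_⊕ᴱ_ : {X X′ Y Y′ : Poset} → Embedding X X′ → Embedding Y Y′ → Embedding (X ⊕ Y) (X′ ⊕ Y′)
f ⊕ᴱ g = record
  { fun    = Sum.map F.fun G.fun
  ; inj    = λ { {inj₁ _} {inj₁ _} e → cong inj₁ (F.inj (inj₁-injective e))
               ; {inj₂ _} {inj₂ _} e → cong inj₂ (G.inj (inj₂-injective e)) }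
  ; mono   = λ _ _ → Pointwise.map (F.mono _ _) (G.mono _ _)
  ; refl-≤ = λ { (inj₁ _) (inj₁ _) (inj₁ p) → inj₁ (F.refl-≤ _ _ p)
               ; (inj₂ _) (inj₂ _) (inj₂ p) → inj₂ (G.refl-≤ _ _ p) }
  }
  where
    module F = Embedding f
    module G = Embedding g

⊕-labelling : {X Y : Poset} {n : ℕ} →
  ComponentLabelling X n → Connected Y → Carrier Y → ComponentLabelling (X ⊕ Y) (suc n)
⊕-labelling {X} {Y} cX conY y₀ = record
  { label                = label′
  ; label-step           = step
  ; path                 = path′
  ; representative       = λ { zero → inj₂ y₀ ; (suc i) → inj₁ (representative i) }
  ; label-representative = λ { zero → refl ; (suc i) → cong suc (label-representative i) }
  }
  where
    open ComponentLabelling cX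
    label′ : Carrier (X ⊕ Y) → Fin (suc _)
    label′ = Sum.[ suc ∘ label , (λ _ → zero) ]
    step : ∀ {x y} → Comparable (X ⊕ Y) x y → label′ x ≡ label′ y
    step (inj₁ (inj₁ p)) = cong suc (label-step (inj₁ p))
    step (inj₂ (inj₁ p)) = cong suc (label-step (inj₂ p))
    step (inj₁ (inj₂ _)) = refl
    step (inj₂ (inj₂ _)) = refl
    path′ : ∀ {x y} → label′ x ≡ label′ y → Star (Comparable (X ⊕ Y)) x y
    path′ {inj₁ x} {inj₁ y} e =
      Embedding-map-path (⊕-inj₁ {X} {Y}) (path {x} {y} (Fin.suc-injective e))
    path′ {inj₁ _} {inj₂ _} ()
    path′ {inj₂ _} {inj₁ _} ()
    path′ {inj₂ x} {inj₂ y} _ = Embedding-map-path (⊕-inj₂ {X} {Y}) (conY x y)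

⊕-iterate : Poset → Poset → ℕ → Poset
⊕-iterate X Y zero    = X
⊕-iterate X Y (suc n) = ⊕-iterate X Y n ⊕ Y

⊕-iterate-labelling : (X Y : Poset) {m : ℕ} →
  ComponentLabelling X m → Connected Y → Carrier Y →
  ∀ n → ComponentLabelling (⊕-iterate X Y n) (n ℕ.+ m)
⊕-iterate-labelling X Y cX conY y₀ zero    = cX
⊕-iterate-labelling X Y cX conY y₀ (suc n) =
  ⊕-labelling {Y = Y} (⊕-iterate-labelling X Y cX conY y₀ n) conY y₀

⊕-iterate-absorbed : {X Y : Poset} → Embedding (X ⊕ Y) X → ∀ n → Embedding (⊕-iterate X Y n) X
⊕-iterate-absorbed         absorb zero    = Embedding-id
⊕-iterate-absorbed {Y = Y} absorb (suc n) =
  absorb ∘ᴱ (⊕-iterate-absorbed absorb n ⊕ᴱ Embedding-id {Y})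

⊕-iterate-contains : (X Y : Poset) → ∀ n → Embedding X (⊕-iterate X Y n)
⊕-iterate-contains X Y zero    = Embedding-id
⊕-iterate-contains X Y (suc n) = ⊕-inj₁ {Y = Y} ∘ᴱ ⊕-iterate-contains X Y n

infinitelyManySiblings-of-absorbing : {P Q R : Poset} {m : ℕ} → Sibling Q P →
  ComponentLabelling Q m → Connected R → Carrier R → Embedding (Q ⊕ R) Q →
  InfinitelyManySiblings P
infinitelyManySiblings-of-absorbing {P} {Q} {R} {m} (Q↪P , P↪Q) cQ conR r₀ absorb =
  ⊕-iterate Q R , siblings , non-isomorphic
  where
    siblings : ∀ n → Sibling (⊕-iterate Q R n) P
    siblings n = Q↪P ∘ᴱ ⊕-iterate-absorbed absorb n , ⊕-iterate-contains Q R n ∘ᴱ P↪Q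
    components : ∀ n → ComponentLabelling (⊕-iterate Q R n) (n ℕ.+ m)
    components = ⊕-iterate-labelling Q R cQ conR r₀
    non-isomorphic : ∀ n n′ → n ≢ n′ → ¬ Iso (⊕-iterate Q R n) (⊕-iterate Q R n′)
    non-isomorphic n n′ n≢n′ φ =
      n≢n′ (+-cancelʳ-≡ m n n′ (components-unique φ (components n) (components n′)))

module _ {I : Set} {F : I → Poset} where

  DirectSum-path-index : ∀ {p q} → Star (Comparable (DirectSum F)) p q → proj₁ p ≡ proj₁ q
  DirectSum-path-index ε                     = refl
  DirectSum-path-index (inj₁ (inSum _) ◅ ps) = DirectSum-path-index ps
  DirectSum-path-index (inj₂ (inSum _) ◅ ps) = DirectSum-path-index ps

  DirectSum-extend : {X : Poset} (e : Embedding X (DirectSum F)) (k : I) →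
    (∀ x → proj₁ (Embedding.fun e x) ≢ k) → Embedding (X ⊕ F k) (DirectSum F)
  DirectSum-extend {X} e k avoids =
    record { fun = fun′ ; inj = inj′ ; mono = mono′ ; refl-≤ = refl-≤′ }
    where
      open Embedding e
      fun′ : Carrier (X ⊕ F k) → Carrier (DirectSum F)
      fun′ = Sum.[ fun , (k ,_) ]
      inj′ : ∀ {u v} → fun′ u ≡ fun′ v → u ≡ v
      inj′ {inj₁ _} {inj₁ _} e   = cong inj₁ (inj e)
      inj′ {inj₁ x} {inj₂ _} e   = ⊥-elim (avoids x (cong proj₁ e))
      inj′ {inj₂ _} {inj₁ x} e   = ⊥-elim (avoids x (cong proj₁ (sym e)))
      inj′ {inj₂ _} {inj₂ _} refl = refl
      mono′ : ∀ u v → _≤_ (X ⊕ F k) u v → SumLe F (fun′ u) (fun′ v)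
      mono′ _ _ (inj₁ p) = mono _ _ p
      mono′ _ _ (inj₂ p) = inSum p
      refl-≤′ : ∀ u v → SumLe F (fun′ u) (fun′ v) → _≤_ (X ⊕ F k) u v
      refl-≤′ (inj₁ _) (inj₁ _) p         = inj₁ (refl-≤ _ _ p)
      refl-≤′ (inj₁ x) (inj₂ _) p         = ⊥-elim (avoids x (DirectSum-path-index (inj₁ p ◅ ε)))
      refl-≤′ (inj₂ _) (inj₁ x) p         = ⊥-elim (avoids x (sym (DirectSum-path-index (inj₁ p ◅ ε))))
      refl-≤′ (inj₂ _) (inj₂ _) (inSum p) = inj₂ p

Countable⇒DecidableEquality : ∀ {A : Set} → Countable A → DecidableEquality A
Countable⇒DecidableEquality (code , injective) x y = map′ injective (cong code) (code x ℕ.≟ code y)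

exists-≢ : ∀ {A : Set} → DecidableEquality A → {i i′ : A} → i ≢ i′ → (j : A) → Σ A (_≢ j)
exists-≢ _≟_ {i} {i′} i≢i′ j with i ≟ j
... | yes refl = i′ , i≢i′ ∘ sym
... | no i≢j   = i , i≢j

mainTheorem18 : (I : Set) → Countable I → Σ I (λ i → Σ I (λ j → i ≢ j)) →
    (F : I → Poset) →
    (∀ i → Countable (Carrier (F i))) →
    (∀ i → NonEmpty (F i)) →
    (∀ i → Connected (F i)) →
    (∀ i → NEFree (F i)) →
    Σ Poset (λ Q → Sibling Q (DirectSum F) × Connected Q) →
    InfinitelyManySiblings (DirectSum F)
mainTheorem18 I countable (i , i′ , i≢i′) F _ nonEmpty connected _ (Q , (Q↪P , P↪Q) , connectedQ) =
  infinitelyManySiblings-of-absorbing {R = F k} (Q↪P , P↪Q) (connected-labelling connectedQ q₀)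
    (connected k) (nonEmpty k) (P↪Q ∘ᴱ DirectSum-extend Q↪P k avoids)
  where
    open Embedding Q↪P
    q₀ : Carrier Q
    q₀ = Embedding.fun P↪Q (i , nonEmpty i)
    j : I
    j = proj₁ (fun q₀)
    other : Σ I (_≢ j)
    other = exists-≢ (Countable⇒DecidableEquality countable) i≢i′ j
    k : I
    k = proj₁ other
    avoids : ∀ q → proj₁ (fun q) ≢ k
    avoids q e = proj₂ other
      (trans (sym e) (sym (DirectSum-path-index (Embedding-map-path Q↪P (connectedQ q₀ q)))))
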